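{- Let $\tau$ be a tree rooted at $r$. For any $k \in \mathbb{N}$ and $j \in \{0, 1, \dots, k-1\}$, $$V(\tau) = \bigcup_{v \in \mathcal{C}_k^j(\tau) \cup \{r\}} B_{2k}(v).$$
   Context: For a rooted tree $\tau$ with root $r$ and $i \in \mathbb{N}_0$, $\ell_i(\tau) = \{v \in V(\tau) : d_\tau(r,v) = i\}$ is the set of vertices at depth $i$. The height is $h(\tau) = \sup\{i : \ell_i(\tau) \ne \emptyset\}$. For $v \in V(\tau)$, $\tau_v$ is the full subtree of $\tau$ rooted at $v$ (consisting of $v$ and all its descendants). For $k \in \mathbb{N}$ and $j \in \{0,\dots,k-1\}$, $\mathcal{C}_k^j(\tau) = \bigcup_{i=0}^\infty \{v \in \ell_{ik+j}(\tau) : h(\tau_v) \ge k\}$. $B_{2k}(v)$ is the set of vertices at graph distance at most $2k$ from $v$ in $\tau$. -}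

module Defs where

open import Level using (Level; _⊔_)
open import Data.Nat using (ℕ; zero; suc; _+_; _*_; _≤_; _<_)
open import Data.List using (List; []; _∷_; _++_; length)
open import Data.Product using (Σ; ∃; _×_; _,_)
open import Data.Sum using (_⊎_)
open import Relation.Binary.PropositionalEquality using (_≡_)

-- A rooted tree in Ulam–Harris style, with child labels from an arbitrary
-- type A (so arbitrary branching is allowed; taking A = the vertex set of
-- any rooted tree shows this is fully general).  A vertex is an address:
-- the list of child labels read from the vertex up to the root, so the
-- root is [] and the parent of (x ∷ v) is v.  The tree may be infinite.
record RootedTree {a} (A : Set a) ℓ : Set (a ⊔ Level.suc ℓ) where
  field
    V         : List A → Set ℓ
    root∈     : V []
    parent∈   : ∀ {x v} → V (x ∷ v) → V v

module _ {a ℓ} {A : Set a} (τ : RootedTree A ℓ) where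
  open RootedTree τ

  root : List A
  root = []

  depth : List A → ℕ
  depth = length

  Adj : List A → List A → Set (a ⊔ ℓ)
  Adj u w = (V u × V w) × ((Σ A λ x → u ≡ x ∷ w) ⊎ (Σ A λ x → w ≡ x ∷ u))

  data Walk : List A → List A → ℕ → Set (a ⊔ ℓ) where
    stay : ∀ {u} → V u → Walk u u 0
    step : ∀ {u w z n} → Adj u w → Walk w z n → Walk u z (suc n)

  DistLe : List A → List A → ℕ → Set (a ⊔ ℓ)
  DistLe u w m = Σ ℕ λ n → n ≤ m × Walk u w n

  InBall : ℕ → List A → List A → Set (a ⊔ ℓ)
  InBall k v u = DistLe v u (2 * k)

  -- h(τ_v) ≥ k : the full subtree at v has a vertex at (relative) depth ≥ k,
  -- i.e. some descendant w ++ v of v lies in τ with |w| ≥ k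
  HeightGe : List A → ℕ → Set (a ⊔ ℓ)
  HeightGe v k = Σ (List A) λ w → V (w ++ v) × k ≤ length w

  InC : ℕ → ℕ → List A → Set (a ⊔ ℓ)
  InC k j v = V v × (Σ ℕ λ i → depth v ≡ i * k + j) × HeightGe v k

{-# OPTIONS --safe #-}
-- Write d for the depth of u. If d < k + j the root is within distance 2k of u.
-- Otherwise write d ∸ (k + j) = i k + r with r < k; the ancestor v of u at depth
-- i k + j lies k + r ∈ [k, 2k) levels above u, so u witnesses h(τ_v) ≥ k, whence
-- v ∈ 𝒞_k^j(τ), and the path from v down to u has length at most 2k.
module Submission where

open import Defs
open import Data.Nat using (ℕ; _<_; NonZero; zero; suc; _+_; _*_; _∸_; _≤_; z≤n; s≤s; _/_; _%_)
open import Data.Nat.Properties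
open import Data.Nat.DivMod using (m≡m%n+[m/n]*n; m%n<n)
open import Data.Nat.Tactic.RingSolver using (solve-∀)
open import Data.List using (List; []; _∷_; length; take; drop)
open import Data.List.Properties using (length-take; length-drop; take++drop≡id)
open import Data.Product using (Σ; _×_; _,_)
open import Data.Sum using (_⊎_; inj₁; inj₂)
open import Relation.Binary.PropositionalEquality
open import Relation.Nullary using (yes; no)

drop-length : ∀ {a} {A : Set a} (u : List A) → drop (length u) u ≡ []
drop-length []      = refl
drop-length (_ ∷ u) = drop-length u

m<n⇒n+m≤2*n : ∀ {m n} → m < n → n + m ≤ 2 * n
m<n⇒n+m≤2*n {m} {n} m<n = subst (n + m ≤_) (cong (n +_) (sym (+-identityʳ n))) (+-monoʳ-≤ n (<⇒≤ m<n))

module _ {k : ℕ} .{{_ : NonZero k}} where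

  k+j≤d⇒d≡k+r+[i*k+j] : ∀ {j d} → k + j ≤ d →
                Σ ℕ λ i → Σ ℕ λ r → r < k × d ≡ (k + r) + (i * k + j)
  k+j≤d⇒d≡k+r+[i*k+j] {j} {d} k+j≤d = m / k , m % k , m%n<n m k , d≡
    where
    m = d ∸ (k + j)
    rearrange : ∀ k j r s → (k + j) + (r + s) ≡ (k + r) + (s + j)
    rearrange = solve-∀
    d≡ : d ≡ (k + m % k) + (m / k * k + j)
    d≡ = begin
      d                                  ≡⟨ m+[n∸m]≡n k+j≤d ⟨
      (k + j) + m                        ≡⟨ cong ((k + j) +_) (m≡m%n+[m/n]*n m k) ⟩
      (k + j) + (m % k + m / k * k)      ≡⟨ rearrange k j (m % k) (m / k * k) ⟩
      (k + m % k) + (m / k * k + j)      ∎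
      where open ≡-Reasoning

module _ {a ℓ} {A : Set a} (τ : RootedTree A ℓ) where
  open RootedTree τ

  Walk-target∈ : ∀ {u w n} → Walk τ u w n → V w
  Walk-target∈ (stay w∈)  = w∈
  Walk-target∈ (step _ p) = Walk-target∈ p

  Walk-snoc : ∀ {u w z n} → Walk τ u w n → Adj τ w z → Walk τ u z (suc n)
  Walk-snoc (stay _)   e@((_ , z∈) , _) = step e (stay z∈)
  Walk-snoc (step e p) e′               = step e (Walk-snoc p e′)

  DistLe-mono : ∀ {u w m n} → m ≤ n → DistLe τ u w m → DistLe τ u w n
  DistLe-mono m≤n (l , l≤m , p) = l , ≤-trans l≤m m≤n , p

  HeightGe-mono : ∀ {v m n} → m ≤ n → HeightGe τ v n → HeightGe τ v m
  HeightGe-mono m≤n (w , w++v∈ , n≤w) = w , w++v∈ , ≤-trans m≤n n≤w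

  drop∈ : ∀ n {u} → V u → V (drop n u)
  drop∈ zero    u∈ = u∈
  drop∈ (suc n) {[]}    u∈ = u∈
  drop∈ (suc n) {_ ∷ u} u∈ = drop∈ n (parent∈ u∈)

  drop-DistLe : ∀ n {u} → V u → DistLe τ (drop n u) u n
  drop-DistLe zero    u∈ = 0 , z≤n , stay u∈
  drop-DistLe (suc n) {[]}    u∈ = 0 , z≤n , stay u∈
  drop-DistLe (suc n) {x ∷ u} u∈ with drop-DistLe n (parent∈ u∈)
  ... | l , l≤n , p = suc l , s≤s l≤n , Walk-snoc p ((parent∈ u∈ , u∈) , inj₂ (x , refl))

  drop-HeightGe : ∀ {n u} → V u → n ≤ length u → HeightGe τ (drop n u) n
  drop-HeightGe {n} {u} u∈ n≤u =
    take n u , subst V (sym (take++drop≡id n u)) u∈ ,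
    ≤-reflexive (sym (trans (length-take n u) (m≤n⇒m⊓n≡m n≤u)))

lemma1 : ∀ {a ℓ} {A : Set a} (τ : RootedTree A ℓ) (k j : ℕ) → .{{NonZero k}} → j < k →
    (u : List A) →
      (RootedTree.V τ u → Σ (List A) λ v → (InC τ k j v ⊎ v ≡ root τ) × InBall τ k v u)
      × ((Σ (List A) λ v → (InC τ k j v ⊎ v ≡ root τ) × InBall τ k v u) → RootedTree.V τ u)
lemma1 {A = A} τ k j j<k u = covered , λ (_ , _ , _ , _ , p) → Walk-target∈ τ p
  where
  open RootedTree τ
  d = length u

  covered : V u → Σ (List A) λ v → (InC τ k j v ⊎ v ≡ root τ) × InBall τ k v u
  covered u∈ with k + j ≤? d
  ... | no d≱k+j = drop d u , inj₂ (drop-length u) ,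
    DistLe-mono τ (≤-trans (<⇒≤ (≰⇒> d≱k+j)) (m<n⇒n+m≤2*n j<k)) (drop-DistLe τ d u∈)
  ... | yes k+j≤d with k+j≤d⇒d≡k+r+[i*k+j] k+j≤d
  ... | i , r , r<k , d≡ =
    drop (k + r) u , inj₁ (drop∈ τ (k + r) u∈ , (i , depth≡) , height) ,
    DistLe-mono τ (m<n⇒n+m≤2*n r<k) (drop-DistLe τ (k + r) u∈)
    where
    k+r≤d : k + r ≤ d
    k+r≤d = subst (k + r ≤_) (sym d≡) (m≤m+n (k + r) _)
    depth≡ : length (drop (k + r) u) ≡ i * k + j
    depth≡ = trans (length-drop (k + r) u) (trans (cong (_∸ (k + r)) d≡) (m+n∸m≡n (k + r) _))
    height : HeightGe τ (drop (k + r) u) k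
    height = HeightGe-mono τ (m≤m+n k r) (drop-HeightGe τ u∈ k+r≤d)
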